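{- For every $G>0$ there is a finite sequence $\sigma$ of positive integers with $\nu(\sigma)=0$ such that the difference between the largest value of $\sigma$ and the second largest distinct value of $\sigma$ exceeds $G$.
   Context: For a finite sequence $(a_1,\dots,a_N)$ (repetitions allowed), $\nu(a_1,\dots,a_N)=\big(\sum a_i\big)^2-\sum a_i^3$. -}

module Defs where

open import Data.Nat using (ℕ; _+_; _*_; _^_; _≤_; _<_)
open import Data.List using (List; map)
open import Data.Nat.ListAction using (sum)
open import Data.List.Membership.Propositional using (_∈_)
open import Data.Product using (_×_)
open import Relation.Binary.PropositionalEquality using (_≡_)

-- ν(a₁,…,a_N) = (Σ aᵢ)² − Σ aᵢ³ ; since everything is a natural number,
-- ν(σ) = 0 is exactly the equation (Σ aᵢ)² = Σ aᵢ³.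
NuZero : List ℕ → Set
NuZero σ = sum σ ^ 2 ≡ sum (map (λ a → a ^ 3) σ)

IsLargestValue : List ℕ → ℕ → Set
IsLargestValue σ a = a ∈ σ × (∀ x → x ∈ σ → x ≤ a)

IsSecondLargestDistinctValue : List ℕ → ℕ → ℕ → Set
IsSecondLargestDistinctValue σ a b =
  b ∈ σ × b < a × (∀ x → x ∈ σ → x < a → x ≤ b)

{-# OPTIONS --safe #-}
module Submission where

-- Take the value r(r+1) once and the value r+1 repeated r² times. The sum is
-- r(r+1) + r²(r+1) = r(r+1)², whose square r²(r+1)⁴ equals the sum of cubes
-- r³(r+1)³ + r²(r+1)³. The two distinct values differ by (r−1)(r+1), so any
-- gap G is exceeded by taking r = G + 2.

open import Defs
open import Data.Nat using (ℕ; zero; suc; _+_; _*_; _^_; _<_; _≤_; s≤s; z≤n)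
open import Data.Nat.Properties using (≤-refl; <⇒≤; <-irrefl; m<m+n; m≤m*n; +-monoʳ-<)
open import Data.Nat.Tactic.RingSolver using (solve-∀)
open import Data.List using (List; _∷_; replicate; map)
open import Data.List.Properties using (map-replicate)
open import Data.Nat.ListAction using (sum)
open import Data.List.Relation.Unary.All using (All; _∷_; lookup)
open import Data.List.Relation.Unary.All.Properties using (replicate⁺)
open import Data.List.Relation.Unary.Any using (here; there)
open import Data.Product using (Σ; _×_; _,_)
open import Data.Empty using (⊥-elim)
open import Relation.Binary.PropositionalEquality using (_≡_; refl; sym; cong; module ≡-Reasoning)

sum-replicate : ∀ k t → sum (replicate k t) ≡ k * t
sum-replicate zero    t = refl
sum-replicate (suc k) t = cong (t +_) (sum-replicate k t)

nuZero-∷-replicate : ∀ m k t → (m + k * t) ^ 2 ≡ m ^ 3 + k * t ^ 3 →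
                     NuZero (m ∷ replicate k t)
nuZero-∷-replicate m k t eq = begin
  (m + sum (replicate k t)) ^ 2                     ≡⟨ cong (λ s → (m + s) ^ 2) (sum-replicate k t) ⟩
  (m + k * t) ^ 2                                   ≡⟨ eq ⟩
  m ^ 3 + k * t ^ 3                                 ≡⟨ cong (m ^ 3 +_) (sym (sum-replicate k (t ^ 3))) ⟩
  m ^ 3 + sum (replicate k (t ^ 3))                 ≡⟨ cong (λ xs → m ^ 3 + sum xs) (sym (map-replicate (_^ 3) k t)) ⟩
  m ^ 3 + sum (map (λ a → a ^ 3) (replicate k t))   ∎
  where open ≡-Reasoning

largestValue-∷-replicate : ∀ m k t → t ≤ m → IsLargestValue (m ∷ replicate k t) m
largestValue-∷-replicate m k t t≤m = here refl , λ _ → lookup (≤-refl ∷ replicate⁺ k t≤m)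

secondLargestDistinctValue-∷-replicate : ∀ m k t → 0 < k → t < m →
  IsSecondLargestDistinctValue (m ∷ replicate k t) m t
secondLargestDistinctValue-∷-replicate m (suc k) t _ t<m =
  there (here refl) , t<m , λ _ → lookup (below-m ∷ replicate⁺ (suc k) (λ _ → ≤-refl))
  where
  below-m : m < m → m ≤ t
  below-m m<m = ⊥-elim (<-irrefl refl m<m)

square-of-sum≡sum-of-cubes : ∀ r →
  (r * (1 + r) + r * r * (1 + r)) ^ 2 ≡ (r * (1 + r)) ^ 3 + r * r * (1 + r) ^ 3
square-of-sum≡sum-of-cubes = unfolded
  where
  -- The reflective solver cannot read `_^_`, so the powers are unfolded as `_^_` computes them.
  unfolded : ∀ r → let m = r * (1 + r); s = m + r * r * (1 + r); t = 1 + r in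
             s * (s * 1) ≡ m * (m * (m * 1)) + r * r * (t * (t * (t * 1)))
  unfolded = solve-∀

mainTheorem14 : (G : ℕ) → 0 < G →
    Σ (List ℕ) λ σ → All (0 <_) σ × NuZero σ ×
    Σ ℕ λ a → Σ ℕ λ b →
    IsLargestValue σ a × IsSecondLargestDistinctValue σ a b × b + G < a
mainTheorem14 G _ =
  m ∷ replicate k t , s≤s z≤n ∷ replicate⁺ k (s≤s z≤n) ,
  nuZero-∷-replicate m k t (square-of-sum≡sum-of-cubes r) ,
  m , t , largestValue-∷-replicate m k t (<⇒≤ t<m) ,
  secondLargestDistinctValue-∷-replicate m k t (s≤s z≤n) t<m , gap
  where
  r t m k : ℕ
  r = suc (suc G)
  t = suc r
  m = r * t
  k = r * r
  t<m : t < m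
  t<m = m<m+n t (s≤s z≤n)
  gap : t + G < m
  gap = +-monoʳ-< t (m≤m*n (suc G) t)
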